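{- Let $G$ be any graph. Then $\gamma_R(\mu(G))=\gamma_R(G)+2$ if and only if $G$ is not a special Roman graph.
   Context: All graphs are finite and simple. A Roman dominating function (RDF) of $G=(V,E)$ is a function $f:V\to\{0,1,2\}$ such that every vertex $v$ with $f(v)=0$ has a neighbor $w$ with $f(w)=2$; its weight is $\sum_v f(v)$, $\gamma_R(G)$ is the minimum weight of an RDF, and a $\gamma_R$-function is an RDF of weight $\gamma_R(G)$. Write $f=(V_0,V_1,V_2)$ with $V_i=\{v:f(v)=i\}$. $G$ is a special Roman graph if it has a $\gamma_R$-function $f=(V_0,V_1,V_2)$ with $V_1=\emptyset$ such that $G[V_2]$ has no isolated vertex. The Mycielskian $\mu(G)$ of $G$ with $V(G)=\{v_1^0,\ldots,v_n^0\}$ has vertex set $\{v_j^0\}\cup\{v_j^1\}\cup\{u\}$ and edge set $E(G)\cup\{v_j^0v_{j'}^1 : v_j^0v_{j'}^0\in E(G)\}\cup\{v_j^1u: 1\leq j\leq n\}$. -}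

module Defs where

open import Data.Nat using (ℕ; zero; suc; _+_; _≤_)
open import Data.Fin using (Fin; zero; suc; splitAt)
open import Data.Sum using (_⊎_; inj₁; inj₂)
open import Data.Product using (Σ; _×_; ∃; ∃-syntax; _,_)
open import Data.Empty using (⊥)
open import Data.Unit using (⊤)
open import Data.Vec using (tabulate)
open import Data.Vec using () renaming (sum to vsum)
open import Relation.Nullary using (¬_; Dec; yes; no)
open import Relation.Binary.PropositionalEquality using (_≡_)

record Graph (n : ℕ) : Set₁ where
  field
    Adj     : Fin n → Fin n → Set
    adj?    : ∀ x y → Dec (Adj x y)
    sym     : ∀ {x y} → Adj x y → Adj y x
    irrefl  : ∀ {x} → ¬ Adj x x
open Graph public

Label : Set
Label = Fin 3

val : Label → ℕ
val zero = 0
val (suc zero) = 1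
val (suc (suc zero)) = 2

weight : ∀ {n} → (Fin n → Label) → ℕ
weight {n} f = vsum (tabulate (λ v → val (f v)))

two : Label
two = suc (suc zero)

one : Label
one = suc zero

IsRDF : ∀ {n} → Graph n → (Fin n → Label) → Set
IsRDF G f = ∀ v → f v ≡ zero → ∃[ w ] (Adj G v w × f w ≡ two)

IsGammaRFunction : ∀ {n} → Graph n → (Fin n → Label) → Set
IsGammaRFunction G f = IsRDF G f × (∀ g → IsRDF G g → weight f ≤ weight g)

RomanDomNumber : ∀ {n} → Graph n → ℕ → Set
RomanDomNumber G k = ∃[ f ] (IsGammaRFunction G f × weight f ≡ k)

IsSpecialRoman : ∀ {n} → Graph n → Set
IsSpecialRoman G = ∃[ f ] ( IsGammaRFunction G f
                          × (∀ v → ¬ f v ≡ one)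
                          × (∀ v → f v ≡ two → ∃[ w ] (Adj G v w × f w ≡ two)))

-- Mycielskian vertices: Fin (suc (n + n)); zero is u, suc i with
-- splitAt n i = inj₁ j is v_j^0, inj₂ j is v_j^1.
data MVert (n : ℕ) : Set where
  U  : MVert n
  V0 : Fin n → MVert n
  V1 : Fin n → MVert n

classify : ∀ {n} → Fin (suc (n + n)) → MVert n
classify zero = U
classify {n} (suc i) with splitAt n i
... | inj₁ j = V0 j
... | inj₂ j = V1 j

MAdj : ∀ {n} → Graph n → MVert n → MVert n → Set
MAdj G (V0 a) (V0 b) = Adj G a b
MAdj G (V0 a) (V1 b) = Adj G a b
MAdj G (V1 a) (V0 b) = Adj G a b
MAdj G (V1 a) U = ⊤
MAdj G U (V1 b) = ⊤
MAdj G _ _ = ⊥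

MAdj? : ∀ {n} (G : Graph n) x y → Dec (MAdj G x y)
MAdj? G (V0 a) (V0 b) = adj? G a b
MAdj? G (V0 a) (V1 b) = adj? G a b
MAdj? G (V1 a) (V0 b) = adj? G a b
MAdj? G (V1 a) U = yes _
MAdj? G U (V1 b) = yes _
MAdj? G U U = no (λ ())
MAdj? G U (V0 _) = no (λ ())
MAdj? G (V0 _) U = no (λ ())
MAdj? G (V1 _) (V1 _) = no (λ ())

MAdj-sym : ∀ {n} (G : Graph n) {x y} → MAdj G x y → MAdj G y x
MAdj-sym G {V0 a} {V0 b} p = sym G p
MAdj-sym G {V0 a} {V1 b} p = sym G p
MAdj-sym G {V1 a} {V0 b} p = sym G p
MAdj-sym G {V1 a} {U} p = _
MAdj-sym G {U} {V1 b} p = _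

MAdj-irrefl : ∀ {n} (G : Graph n) {x} → ¬ MAdj G x x
MAdj-irrefl G {V0 a} p = irrefl G p
MAdj-irrefl G {U} ()
MAdj-irrefl G {V1 a} ()

mycielskian : ∀ {n} → Graph n → Graph (suc (n + n))
mycielskian G = record
  { Adj = λ x y → MAdj G (classify x) (classify y)
  ; adj? = λ x y → MAdj? G (classify x) (classify y)
  ; sym = λ {x} {y} → MAdj-sym G {classify x} {classify y}
  ; irrefl = λ {x} → MAdj-irrefl G {classify x}
  }

-- Labelling u with 2 and the shadow with 0 extends any RDF of G, so γ_R(μ(G)) ≤ γ_R(G) + 2;
-- if G is special, u may be labelled 1 instead, since each shadow vertex v¹ is dominated
-- by the copy of a 2-labelled neighbour of v.  Conversely, let h be an RDF of μ(G) with
-- labels a on the copy {v⁰} of G and b on the shadow {v¹}.  Labelling a vertex 2 when a or b is 2,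
-- and a otherwise, gives an RDF of G of weight at most |a| + |b|, which settles h(u) = 2.
-- If h(u) ≠ 2, every shadow 0 sits next to a copy 2, so the repair of a (keep the 2s,
-- put 0 on vertices with a 2-neighbour and 1 elsewhere) is an RDF of G of weight at most
-- |a| + |b|; it saves 2 when h(u) = 0 (some shadow vertex is labelled 2) and 1 when some
-- vertex has no 2-neighbour.  So an RDF of μ(G) of weight at most γ_R(G) + 1 has h(u) = 1
-- and |a| + |b| = γ_R(G), every vertex has a 2-neighbour, and the repair is special.

module Submission where

open import Defs hiding (sym)
open import Data.Nat.Properties
open import Algebra.Properties.CommutativeMonoid.Sum +-0-commutativeMonoid
  using (sum; sum-remove; ∑-distrib-+; sum-cong-≗; sum-replicate-zero)
open import Algebra.Properties.CommutativeSemigroup +-commutativeSemigroup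
  using (interchange; xy∙z≈xz∙y)
open import Data.Fin using (Fin; zero; suc; _↑ˡ_; _↑ʳ_; splitAt; join; punchIn; punchOut)
open import Data.Fin.Properties
  using (splitAt-↑ˡ; splitAt-↑ʳ; join-splitAt; punchIn-punchOut; any?)
  renaming (_≟_ to _≟ᶠ_)
open import Data.Nat using (ℕ; zero; suc; _+_; _≤_; z≤n; s≤s)
open import Data.Product using (∃-syntax; _×_; _,_)
open import Data.Sum using (_⊎_; inj₁; inj₂)
open import Data.Unit using (tt)
open import Data.Vec.Functional using (removeAt)
open import Function using (_∘_; const)
open import Function.Bundles using (_⇔_; mk⇔)
open import Relation.Binary.PropositionalEquality
  using (_≡_; _≢_; _≗_; refl; sym; trans; cong; cong₂; subst; subst₂; module ≡-Reasoning)
open import Relation.Nullary using (¬_; Dec; yes; no; contradiction)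
open import Relation.Nullary.Decidable using (_×-dec_)

weight≡sum : ∀ {n} (f : Fin n → Label) → weight f ≡ sum (val ∘ f)
weight≡sum {zero} f = refl
weight≡sum {suc n} f = cong (val (f zero) +_) (weight≡sum (f ∘ suc))

weight-cong : ∀ {n} {f g : Fin n → Label} → f ≗ g → weight f ≡ weight g
weight-cong {f = f} {g} f≗g = begin
  weight f      ≡⟨ weight≡sum f ⟩
  sum (val ∘ f) ≡⟨ sum-cong-≗ (cong val ∘ f≗g) ⟩
  sum (val ∘ g) ≡⟨ weight≡sum g ⟨
  weight g      ∎
  where open ≡-Reasoning

sum-mono-≤ : ∀ {n} {f g : Fin n → ℕ} → (∀ j → f j ≤ g j) → sum f ≤ sum g
sum-mono-≤ {zero} _ = z≤n
sum-mono-≤ {suc n} f≤g = +-mono-≤ (f≤g zero) (sum-mono-≤ (f≤g ∘ suc))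

sum-mono-≤-gap : ∀ {n} {f g : Fin n → ℕ} {c} → (∀ j → f j ≤ g j) →
                 ∀ x → f x + c ≤ g x → sum f + c ≤ sum g
sum-mono-≤-gap {suc n} {f} {g} {c} f≤g x gap = begin
  sum f + c                          ≡⟨ cong (_+ c) (sum-remove {i = x} f) ⟩
  f x + sum (removeAt f x) + c       ≡⟨ xy∙z≈xz∙y (f x) _ c ⟩
  f x + c + sum (removeAt f x)       ≤⟨ +-mono-≤ gap (sum-mono-≤ (f≤g ∘ punchIn x)) ⟩
  g x + sum (removeAt g x)           ≡⟨ sum-remove {i = x} g ⟨
  sum g                              ∎
  where open ≤-Reasoning

sum-mono-≤-gap₂ : ∀ {n} {f g : Fin n → ℕ} {c d} → (∀ j → f j ≤ g j) →
                  ∀ {x w} → x ≢ w → f x + c ≤ g x → f w + d ≤ g w → sum f + (c + d) ≤ sum g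
sum-mono-≤-gap₂ {suc n} {f} {g} {c} {d} f≤g {x} {w} x≢w gapx gapw = begin
  sum f + (c + d)                    ≡⟨ cong (_+ (c + d)) (sum-remove {i = x} f) ⟩
  f x + sum (removeAt f x) + (c + d) ≡⟨ interchange (f x) _ c d ⟩
  f x + c + (sum (removeAt f x) + d) ≤⟨ +-mono-≤ gapx (sum-mono-≤-gap (f≤g ∘ punchIn x) (punchOut x≢w) gapw′) ⟩
  g x + sum (removeAt g x)           ≡⟨ sum-remove {i = x} g ⟨
  sum g                              ∎
  where
  open ≤-Reasoning
  gapw′ : f (punchIn x (punchOut x≢w)) + d ≤ g (punchIn x (punchOut x≢w))
  gapw′ rewrite punchIn-punchOut x≢w = gapw

sum-↑ : ∀ m {n} (f : Fin (m + n) → ℕ) → sum f ≡ sum (f ∘ (_↑ˡ n)) + sum (f ∘ (m ↑ʳ_))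
sum-↑ zero f = refl
sum-↑ (suc m) f = trans (cong (f zero +_) (sum-↑ m (f ∘ suc))) (sym (+-assoc (f zero) _ _))

RomanDominating : {A : Set} → (A → A → Set) → (A → Label) → Set
RomanDominating R f = ∀ v → f v ≡ zero → ∃[ w ] (R v w × f w ≡ two)

HasTwoNeighbour : ∀ {n} → Graph n → (Fin n → Label) → Fin n → Set
HasTwoNeighbour G f v = ∃[ w ] (Adj G v w × f w ≡ two)

hasTwoNeighbour? : ∀ {n} (G : Graph n) f v → Dec (HasTwoNeighbour G f v)
hasTwoNeighbour? G f v = any? (λ w → adj? G v w ×-dec (f w ≟ᶠ two))

RomanLowerBound : ∀ {n} → Graph n → ℕ → Set
RomanLowerBound G k = ∀ f → IsRDF G f → k ≤ weight f

isGammaRFunction : ∀ {n} (G : Graph n) {f k} → IsRDF G f → RomanLowerBound G k →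
                   weight f ≤ k → IsGammaRFunction G f
isGammaRFunction G f-rdf bound f≤k = f-rdf , λ g g-rdf → ≤-trans f≤k (bound g g-rdf)

-- The decision is whether the vertex has a neighbour labelled 2 (see repair).
repairLabel : ∀ {P : Set} → Label → Dec P → Label
repairLabel (suc (suc zero)) _ = two
repairLabel _ (yes _) = zero
repairLabel _ (no _) = one

repairLabel-two : ∀ {P : Set} {x} (d : Dec P) → x ≡ two → repairLabel x d ≡ two
repairLabel-two d refl = refl

repairLabel-zero : ∀ {P : Set} x (d : Dec P) → repairLabel x d ≡ zero → P
repairLabel-zero zero (yes p) _ = p
repairLabel-zero (suc zero) (yes p) _ = p
repairLabel-zero zero (no _) ()
repairLabel-zero (suc zero) (no _) ()
repairLabel-zero (suc (suc zero)) _ ()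

repairLabel-one : ∀ {P : Set} x (d : Dec P) → repairLabel x d ≡ one → ¬ P
repairLabel-one zero (no ¬p) _ = ¬p
repairLabel-one (suc zero) (no ¬p) _ = ¬p
repairLabel-one zero (yes _) ()
repairLabel-one (suc zero) (yes _) ()
repairLabel-one (suc (suc zero)) _ ()

val-repairLabel-≤ : ∀ {P : Set} x y (d : Dec P) → (y ≡ zero → P) →
                    val (repairLabel x d) ≤ val x + val y
val-repairLabel-≤ (suc (suc zero)) y d _ = m≤m+n 2 (val y)
val-repairLabel-≤ zero y (yes _) _ = z≤n
val-repairLabel-≤ (suc zero) y (yes _) _ = z≤n
val-repairLabel-≤ (suc zero) y (no _) _ = m≤m+n 1 (val y)
val-repairLabel-≤ zero zero (no ¬p) y≡0⇒p = contradiction (y≡0⇒p refl) ¬p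
val-repairLabel-≤ zero (suc zero) (no _) _ = ≤-refl
val-repairLabel-≤ zero (suc (suc zero)) (no _) _ = s≤s z≤n

val-repairLabel-+1 : ∀ {P : Set} x {y} (d : Dec P) → y ≡ two →
                     val (repairLabel x d) + 1 ≤ val x + val y
val-repairLabel-+1 (suc (suc zero)) d refl = s≤s (s≤s (s≤s z≤n))
val-repairLabel-+1 zero (yes _) refl = s≤s z≤n
val-repairLabel-+1 zero (no _) refl = ≤-refl
val-repairLabel-+1 (suc zero) (yes _) refl = s≤s z≤n
val-repairLabel-+1 (suc zero) (no _) refl = s≤s (s≤s z≤n)

val-repairLabel-+2 : ∀ {P : Set} x {y} (d : Dec P) → y ≡ two → (x ≡ zero → P) →
                     val (repairLabel x d) + 2 ≤ val x + val y
val-repairLabel-+2 (suc (suc zero)) d refl _ = ≤-refl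
val-repairLabel-+2 zero (yes _) refl _ = ≤-refl
val-repairLabel-+2 zero (no ¬p) refl x≡0⇒p = contradiction (x≡0⇒p refl) ¬p
val-repairLabel-+2 (suc zero) (yes _) refl _ = s≤s (s≤s z≤n)
val-repairLabel-+2 (suc zero) (no _) refl _ = ≤-refl

val-repairLabel-+1-unprotected : ∀ {P : Set} x y (d : Dec P) → ¬ P → x ≢ zero → y ≢ zero →
                                 val (repairLabel x d) + 1 ≤ val x + val y
val-repairLabel-+1-unprotected x y (yes p) ¬p _ _ = contradiction p ¬p
val-repairLabel-+1-unprotected zero y (no _) _ x≢0 _ = contradiction refl x≢0
val-repairLabel-+1-unprotected x zero (no _) _ _ y≢0 = contradiction refl y≢0
val-repairLabel-+1-unprotected (suc zero) (suc zero) (no _) _ _ _ = ≤-refl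
val-repairLabel-+1-unprotected (suc zero) (suc (suc zero)) (no _) _ _ _ = s≤s (s≤s z≤n)
val-repairLabel-+1-unprotected (suc (suc zero)) (suc zero) (no _) _ _ _ = ≤-refl
val-repairLabel-+1-unprotected (suc (suc zero)) (suc (suc zero)) (no _) _ _ _ = s≤s (s≤s (s≤s z≤n))

mergeLabel : Label → Label → Label
mergeLabel x (suc (suc zero)) = two
mergeLabel x _ = x

mergeLabel-zero : ∀ x y → mergeLabel x y ≡ zero → x ≡ zero
mergeLabel-zero x zero eq = eq
mergeLabel-zero x (suc zero) eq = eq
mergeLabel-zero x (suc (suc zero)) ()

mergeLabel-twoˡ : ∀ {x} y → x ≡ two → mergeLabel x y ≡ two
mergeLabel-twoˡ zero eq = eq
mergeLabel-twoˡ (suc zero) eq = eq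
mergeLabel-twoˡ (suc (suc zero)) eq = refl

mergeLabel-twoʳ : ∀ x {y} → y ≡ two → mergeLabel x y ≡ two
mergeLabel-twoʳ x refl = refl

val-mergeLabel-≤ : ∀ x y → val (mergeLabel x y) ≤ val x + val y
val-mergeLabel-≤ x zero = m≤m+n (val x) 0
val-mergeLabel-≤ x (suc zero) = m≤m+n (val x) 1
val-mergeLabel-≤ x (suc (suc zero)) = m≤n+m 2 (val x)

repair : ∀ {n} → Graph n → (Fin n → Label) → Fin n → Label
repair G f v = repairLabel (f v) (hasTwoNeighbour? G f v)

repair-two : ∀ {n} (G : Graph n) f {v} → f v ≡ two → repair G f v ≡ two
repair-two G f {v} = repairLabel-two (hasTwoNeighbour? G f v)

repair-isRDF : ∀ {n} (G : Graph n) f → IsRDF G (repair G f)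
repair-isRDF G f v eq with repairLabel-zero (f v) (hasTwoNeighbour? G f v) eq
... | w , vw , fw≡2 = w , vw , repair-two G f fw≡2

isSpecialRoman-repair : ∀ {n} (G : Graph n) f {k} → RomanLowerBound G k →
                        weight (repair G f) ≤ k → (∀ v → HasTwoNeighbour G f v) → IsSpecialRoman G
isSpecialRoman-repair G f bound ≤k protected =
  repair G f , isGammaRFunction G (repair-isRDF G f) bound ≤k , no-one , twos-not-isolated
  where
  no-one : ∀ v → ¬ repair G f v ≡ one
  no-one v eq = repairLabel-one (f v) (hasTwoNeighbour? G f v) eq (protected v)

  twos-not-isolated : ∀ v → repair G f v ≡ two → HasTwoNeighbour G (repair G f) v
  twos-not-isolated v _ with protected v
  ... | w , vw , fw≡2 = w , vw , repair-two G f fw≡2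

embed : ∀ {n} → MVert n → Fin (suc (n + n))
embed U = zero
embed {n} (V0 j) = suc (j ↑ˡ n)
embed {n} (V1 j) = suc (n ↑ʳ j)

classify-embed : ∀ {n} (m : MVert n) → classify (embed {n} m) ≡ m
classify-embed U = refl
classify-embed {n} (V0 j) rewrite splitAt-↑ˡ n j n = refl
classify-embed {n} (V1 j) rewrite splitAt-↑ʳ n n j = refl

embed-classify : ∀ {n} (x : Fin (suc (n + n))) → embed (classify {n} x) ≡ x
embed-classify zero = refl
embed-classify {n} (suc i) with splitAt n i in eq
... | inj₁ j = cong suc (trans (cong (join n n) (sym eq)) (join-splitAt n n i))
... | inj₂ j = cong suc (trans (cong (join n n) (sym eq)) (join-splitAt n n i))

isRDF-mycielskian : ∀ {n} (G : Graph n) {h} → RomanDominating (MAdj G) h →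
                    IsRDF (mycielskian G) (h ∘ classify {n})
isRDF-mycielskian {n} G {h} h-rd x eq with h-rd (classify {n} x) eq
... | m , xm , hm≡2 = embed m , subst (MAdj G (classify x)) (sym (classify-embed m)) xm ,
                      trans (cong h (classify-embed m)) hm≡2

romanDominating-mycielskian : ∀ {n} (G : Graph n) {g} → IsRDF (mycielskian G) g →
                              RomanDominating (MAdj G) (g ∘ embed {n})
romanDominating-mycielskian {n} G {g} g-rdf m eq with g-rdf (embed m) eq
... | x , mx , gx≡2 = classify {n} x , subst (λ m′ → MAdj G m′ (classify x)) (classify-embed m) mx ,
                      trans (cong g (embed-classify x)) gx≡2

weight-mycielskian : ∀ {n} (g : Fin (suc (n + n)) → Label) →
                     weight g ≡
                     val (g zero) + (weight (g ∘ embed {n} ∘ V0) + weight (g ∘ embed {n} ∘ V1))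
weight-mycielskian {n} g = cong (val (g zero) +_) (begin
  weight (g ∘ suc)                      ≡⟨ weight≡sum (g ∘ suc) ⟩
  sum (val ∘ g ∘ suc)                   ≡⟨ sum-↑ n (val ∘ g ∘ suc) ⟩
  sum (val ∘ copy) + sum (val ∘ shadow) ≡⟨ cong₂ _+_ (weight≡sum copy) (weight≡sum shadow) ⟨
  weight copy + weight shadow           ∎)
  where
  open ≡-Reasoning
  copy shadow : Fin n → Label
  copy = g ∘ embed ∘ V0
  shadow = g ∘ embed ∘ V1

weight-classify : ∀ {n} (h : MVert n → Label) →
                  weight (h ∘ classify {n}) ≡ val (h U) + (weight (h ∘ V0) + weight (h ∘ V1))
weight-classify {n} h = trans (weight-mycielskian {n} (h ∘ classify {n}))
  (cong₂ (λ w₀ w₁ → val (h U) + (w₀ + w₁))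
         (weight-cong (cong h ∘ classify-embed {n} ∘ V0))
         (weight-cong (cong h ∘ classify-embed {n} ∘ V1)))

extend : ∀ {n} → Label → (Fin n → Label) → MVert n → Label
extend c f U = c
extend c f (V0 j) = f j
extend c f (V1 j) = zero

weight-extend : ∀ {n} c (f : Fin n → Label) → weight (extend c f ∘ classify {n}) ≡ val c + weight f
weight-extend {n} c f = begin
  weight (extend c f ∘ classify)               ≡⟨ weight-classify (extend c f) ⟩
  val c + (weight f + weight {n} (const zero)) ≡⟨ cong (λ w → val c + (weight f + w)) weight-zero ⟩
  val c + (weight f + 0)                       ≡⟨ cong (val c +_) (+-identityʳ (weight f)) ⟩
  val c + weight f                             ∎
  where
  open ≡-Reasoning
  weight-zero : weight {n} (const zero) ≡ 0
  weight-zero = trans (weight≡sum {n} (const zero)) (sum-replicate-zero n)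

extend-two-dominating : ∀ {n} (G : Graph n) {f} → IsRDF G f → RomanDominating (MAdj G) (extend two f)
extend-two-dominating G f-rdf (V0 j) eq with f-rdf j eq
... | w , jw , fw≡2 = V0 w , jw , fw≡2
extend-two-dominating G f-rdf (V1 j) _ = U , tt , refl

extend-one-dominating : ∀ {n} (G : Graph n) {f} → IsRDF G f → (∀ v → ¬ f v ≡ one) →
                        (∀ v → f v ≡ two → HasTwoNeighbour G f v) →
                        RomanDominating (MAdj G) (extend one f)
extend-one-dominating G f-rdf no-one twos-not-isolated (V0 j) eq with f-rdf j eq
... | w , jw , fw≡2 = V0 w , jw , fw≡2
extend-one-dominating G {f} f-rdf no-one twos-not-isolated (V1 j) _ = lift (neighbour (f j) refl)
  where
  neighbour : ∀ x → f j ≡ x → HasTwoNeighbour G f j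
  neighbour zero eq = f-rdf j eq
  neighbour (suc zero) eq = contradiction eq (no-one j)
  neighbour (suc (suc zero)) eq = twos-not-isolated j eq

  lift : HasTwoNeighbour G f j → ∃[ m ] (MAdj G (V1 j) m × extend one f m ≡ two)
  lift (w , jw , fw≡2) = V0 w , jw , fw≡2

module _ {n} (G : Graph n) {h : MVert n → Label} (h-rd : RomanDominating (MAdj G) h) where

  private
    a b : Fin n → Label
    a = h ∘ V0
    b = h ∘ V1

  merge-isRDF : IsRDF G (λ j → mergeLabel (a j) (b j))
  merge-isRDF j eq with h-rd (V0 j) (mergeLabel-zero (a j) (b j) eq)
  ... | V0 w , jw , aw≡2 = w , jw , mergeLabel-twoˡ (b w) aw≡2
  ... | V1 w , jw , bw≡2 = w , jw , mergeLabel-twoʳ (a w) bw≡2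

  shadow-zero⇒hasTwoNeighbour : h U ≢ two → ∀ {j} → b j ≡ zero → HasTwoNeighbour G a j
  shadow-zero⇒hasTwoNeighbour hU≢2 {j} eq with h-rd (V1 j) eq
  ... | V0 w , jw , aw≡2 = w , jw , aw≡2
  ... | U , _ , hU≡2 = contradiction hU≡2 hU≢2

  copy-zero-dominated : ∀ {j} → a j ≡ zero →
                        HasTwoNeighbour G a j ⊎ ∃[ w ] (Adj G j w × b w ≡ two)
  copy-zero-dominated {j} eq with h-rd (V0 j) eq
  ... | V0 w , jw , aw≡2 = inj₁ (w , jw , aw≡2)
  ... | V1 w , jw , bw≡2 = inj₂ (w , jw , bw≡2)

  sum-copies : sum (λ j → val (a j) + val (b j)) ≡ weight a + weight b
  sum-copies = trans (∑-distrib-+ (val ∘ a) (val ∘ b))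
                     (sym (cong₂ _+_ (weight≡sum a) (weight≡sum b)))

  copies-lowerBound : ∀ {k} → RomanLowerBound G k → k ≤ weight a + weight b
  copies-lowerBound bound = ≤-trans (bound _ merge-isRDF) (begin
    weight (λ j → mergeLabel (a j) (b j))      ≡⟨ weight≡sum (λ j → mergeLabel (a j) (b j)) ⟩
    sum (λ j → val (mergeLabel (a j) (b j)))   ≤⟨ sum-mono-≤ (λ j → val-mergeLabel-≤ (a j) (b j)) ⟩
    sum (λ j → val (a j) + val (b j))          ≡⟨ sum-copies ⟩
    weight a + weight b                        ∎)
    where open ≤-Reasoning

  module _ (hU≢2 : h U ≢ two) where

    repair-≤ : ∀ j → val (repair G a j) ≤ val (a j) + val (b j)
    repair-≤ j = val-repairLabel-≤ (a j) (b j) _ (shadow-zero⇒hasTwoNeighbour hU≢2)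

    weight-repair-≤ : weight (repair G a) ≤ weight a + weight b
    weight-repair-≤ = subst₂ _≤_ (sym (weight≡sum (repair G a))) sum-copies (sum-mono-≤ repair-≤)

    weight-repair-gap : ∀ x {c} → val (repair G a x) + c ≤ val (a x) + val (b x) →
                        weight (repair G a) + c ≤ weight a + weight b
    weight-repair-gap x gap =
      subst₂ _≤_ (cong (_+ _) (sym (weight≡sum (repair G a)))) sum-copies
        (sum-mono-≤-gap repair-≤ x gap)

    weight-repair-gap₂ : ∀ {x w} → x ≢ w →
                         val (repair G a x) + 1 ≤ val (a x) + val (b x) →
                         val (repair G a w) + 1 ≤ val (a w) + val (b w) →
                         weight (repair G a) + 2 ≤ weight a + weight b
    weight-repair-gap₂ x≢w gapx gapw =
      subst₂ _≤_ (cong (_+ 2) (sym (weight≡sum (repair G a)))) sum-copies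
        (sum-mono-≤-gap₂ repair-≤ x≢w gapx gapw)

    unprotected⇒weight-repair-+1 : ∀ {j} → ¬ HasTwoNeighbour G a j →
                                   weight (repair G a) + 1 ≤ weight a + weight b
    unprotected⇒weight-repair-+1 {j} ¬p with a j ≟ᶠ zero
    ... | no aj≢0 = weight-repair-gap j (val-repairLabel-+1-unprotected (a j) (b j) _ ¬p aj≢0 bj≢0)
      where bj≢0 : b j ≢ zero
            bj≢0 = ¬p ∘ shadow-zero⇒hasTwoNeighbour hU≢2
    ... | yes aj≡0 with copy-zero-dominated aj≡0
    ...   | inj₁ p = contradiction p ¬p
    ...   | inj₂ (w , _ , bw≡2) = weight-repair-gap w (val-repairLabel-+1 (a w) _ bw≡2)

    special-of-tight : ∀ {k} → RomanLowerBound G k → weight a + weight b ≤ k → IsSpecialRoman G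
    special-of-tight {k} bound ab≤k =
      isSpecialRoman-repair G a bound (≤-trans weight-repair-≤ ab≤k) protected
      where
      protected : ∀ j → HasTwoNeighbour G a j
      protected j with hasTwoNeighbour? G a j
      ... | yes p = p
      ... | no ¬p = contradiction (≤-trans (+-monoˡ-≤ 1 (bound _ (repair-isRDF G a)))
                                    (≤-trans (unprotected⇒weight-repair-+1 ¬p) ab≤k))
                                  (m+1+n≰m k)

  U≡zero⇒weight-repair-+2 : h U ≡ zero → weight (repair G a) + 2 ≤ weight a + weight b
  U≡zero⇒weight-repair-+2 hU≡0 with h-rd U hU≡0
  ... | V1 x , _ , bx≡2 = gap-at-shadow-two x bx≡2
    where
    hU≢2 : h U ≢ two
    hU≢2 hU≡2 = contradiction (trans (sym hU≡0) hU≡2) λ ()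

    gap-at-shadow-two : ∀ x → b x ≡ two → weight (repair G a) + 2 ≤ weight a + weight b
    gap-at-shadow-two x bx≡2 with a x ≟ᶠ zero
    ... | no ax≢0 =
      weight-repair-gap hU≢2 x (val-repairLabel-+2 (a x) _ bx≡2 (λ ax≡0 → contradiction ax≡0 ax≢0))
    ... | yes ax≡0 with copy-zero-dominated ax≡0
    ...   | inj₁ p = weight-repair-gap hU≢2 x (val-repairLabel-+2 (a x) _ bx≡2 (const p))
    ...   | inj₂ (w , xw , bw≡2) =
      weight-repair-gap₂ hU≢2 (λ { refl → irrefl G xw })
        (val-repairLabel-+1 (a x) _ bx≡2) (val-repairLabel-+1 (a w) _ bw≡2)

  mycielskian-lowerBound : ∀ {k} → RomanLowerBound G k → ¬ IsSpecialRoman G →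
                           k + 2 ≤ val (h U) + (weight (h ∘ V0) + weight (h ∘ V1))
  mycielskian-lowerBound {k} bound ¬special with h U in hU
  ... | suc (suc zero) =
    subst (_≤ 2 + (weight a + weight b)) (+-comm 2 k) (+-monoʳ-≤ 2 (copies-lowerBound bound))
  ... | zero = ≤-trans (+-monoˡ-≤ 2 (bound _ (repair-isRDF G a))) (U≡zero⇒weight-repair-+2 hU)
  ... | suc zero with weight a + weight b ≤? k
  ...   | yes ab≤k =
    contradiction (special-of-tight (λ hU≡2 → contradiction (trans (sym hU) hU≡2) λ ()) bound ab≤k) ¬special
  ...   | no ab≰k = subst (_≤ 1 + (weight a + weight b)) (+-comm 2 k) (s≤s (≰⇒> ab≰k))

mycielskian-RomanLowerBound : ∀ {n} (G : Graph n) {k} → RomanLowerBound G k → ¬ IsSpecialRoman G →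
                              RomanLowerBound (mycielskian G) (k + 2)
mycielskian-RomanLowerBound {n} G {k} bound ¬special g g-rdf =
  subst (k + 2 ≤_) (sym (weight-mycielskian {n} g))
    (mycielskian-lowerBound G (romanDominating-mycielskian G g-rdf) bound ¬special)

theorem6 : ∀ {n} (G : Graph n) (k : ℕ) → RomanDomNumber G k →
    RomanDomNumber (mycielskian G) (k + 2) ⇔ (¬ IsSpecialRoman G)
theorem6 {n} G _ (f₀ , (f₀-rdf , bound) , refl) = mk⇔ not-special γR-of-not-special
  where
  not-special : RomanDomNumber (mycielskian G) (weight f₀ + 2) → ¬ IsSpecialRoman G
  not-special (g , (_ , g-min) , wg) (f , (f-rdf , f-min) , no-one , twos-not-isolated) =
    1+n≰n (subst (_≤ 1 + weight f₀) (+-comm (weight f₀) 2) (begin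
      weight f₀ + 2                          ≡⟨ wg ⟨
      weight g                               ≤⟨ g-min _ (isRDF-mycielskian G extend-one-rd) ⟩
      weight (extend one f ∘ classify {n})   ≡⟨ weight-extend one f ⟩
      1 + weight f                           ≤⟨ +-monoʳ-≤ 1 (f-min f₀ f₀-rdf) ⟩
      1 + weight f₀                          ∎))
    where
    open ≤-Reasoning
    extend-one-rd : RomanDominating (MAdj G) (extend one f)
    extend-one-rd = extend-one-dominating G f-rdf no-one twos-not-isolated

  γR-of-not-special : ¬ IsSpecialRoman G → RomanDomNumber (mycielskian G) (weight f₀ + 2)
  γR-of-not-special ¬special =
      extend two f₀ ∘ classify {n}
    , isGammaRFunction (mycielskian G) (isRDF-mycielskian G (extend-two-dominating G f₀-rdf))
        (mycielskian-RomanLowerBound G bound ¬special) (≤-reflexive weight-extend-two)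
    , weight-extend-two
    where
    weight-extend-two : weight (extend two f₀ ∘ classify {n}) ≡ weight f₀ + 2
    weight-extend-two = trans (weight-extend two f₀) (+-comm 2 (weight f₀))
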